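{- (Correspondence of matches.) Let $\alpha\colon L\rightharpoonup R$, $\beta\colon G\rightharpoonup H$, $\gamma\colon S\rightharpoonup T$ be rules and $f\colon L\to G$, $g\colon R\to H$, $f_1\colon L\to S$, $g_1\colon R\to T$ matches such that $f\Rightarrow_\alpha g$ is a derivation with corule $\beta$, $g_1\Rightarrow_{\alpha^\dagger} f_1$ is a derivation with corule $\gamma^\dagger$, and $g_1$ is derivable by $\alpha$. Then the set $M_L=\{f_2\in\mathrm{Match}(S,G)\mid f_2\circ f_1=f\}$ is in one-to-one correspondence with the set $M_R=\{g_2\in\mathrm{Match}(T,H)\mid g_2\circ g_1=g\}$.
   Context: A directed multigraph $G$ consists of finite sets $V_G$, $E_G$ and maps $s_G,t_G\colon E_G\to V_G$; morphisms are pairs of maps on nodes and edges commuting with sources and targets. A match is a morphism injective on nodes and edges; $\mathrm{Match}(A,B)$ is the set of matches $A\to B$. A rule $\alpha\colon L\rightharpoonup R$ is a span $L\xleftarrow{\alpha_1}K\xrightarrow{\alpha_2}R$ of matches; its reverse is $\alpha^\dagger:=(\alpha_2,\alpha_1)\colon R\rightharpoonup L$. Final pullback complement (FPBC) of $X\xrightarrow{f_1}Y\xrightarrow{f_2}Z$: a pair $X\xrightarrow{g_1}W\xrightarrow{g_2}Z$ making a pullback square with $g_2\circ g_1=f_2\circ f_1$, such that for every pullback square $P\xrightarrow{f_1'}Y\xrightarrow{f_2}Z\xleftarrow{g_2'}Q\xleftarrow{g_1'}P$ and $p\colon P\to X$ with $f_1\circ p=f_1'$ there is a unique $u\colon Q\to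 W$ with $g_2\circ u=g_2'$, $u\circ g_1'=g_1\circ p$. A derivation of a comatch $g\colon R\to H$ from a match $f\colon L\to G$ by $\alpha=(\alpha_1\colon K\to L,\alpha_2\colon K\to R)$ consists of a match $h\colon K\to D$ and morphisms $\beta_1\colon D\to G$, $\beta_2\colon D\to H$ such that $K\xrightarrow{h}D\xrightarrow{\beta_1}G$ is an FPBC of $K\xrightarrow{\alpha_1}L\xrightarrow{f}G$, the square $\alpha_2,h,g,\beta_2$ is a pushout of graphs, $g$ is a match and $\beta=(\beta_1,\beta_2)$ is a rule (the corule). Notation $f\Rightarrow_\alpha g$. A match $g_1$ is derivable by $\alpha$ if there is a match $f_1$ with $f_1\Rightarrow_\alpha g_1$. -}

module Defs where

open import Data.Nat using (ℕ)
open import Data.Fin using (Fin)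
open import Data.Product using (Σ; _×_; _,_; proj₁; proj₂)
open import Relation.Binary.PropositionalEquality using (_≡_; refl; sym; trans; cong)
open import Relation.Binary.Bundles using (Setoid)
open import Relation.Binary.Structures using (IsEquivalence)
open import Function.Definitions using (Injective)
open import Function.Bundles using (Inverse)

record Graph : Set where
  field
    nV nE : ℕ
    src tgt : Fin nE → Fin nV

open Graph public

V E : Graph → Set
V G = Fin (nV G)
E G = Fin (nE G)

record Hom (A B : Graph) : Set where
  field
    fV : V A → V B
    fE : E A → E B
    src-comm : ∀ e → fV (src A e) ≡ src B (fE e)
    tgt-comm : ∀ e → fV (tgt A e) ≡ tgt B (fE e)

open Hom public

_≈_ : ∀ {A B} → Hom A B → Hom A B → Set
f ≈ g = (∀ v → fV f v ≡ fV g v) × (∀ e → fE f e ≡ fE g e)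

infix 4 _≈_
infixr 9 _∘_

_∘_ : ∀ {A B C} → Hom B C → Hom A B → Hom A C
_∘_ {A} {B} {C} g f = record
  { fV = λ v → fV g (fV f v)
  ; fE = λ e → fE g (fE f e)
  ; src-comm = λ e → trans (cong (fV g) (src-comm f e)) (src-comm g (fE f e))
  ; tgt-comm = λ e → trans (cong (fV g) (tgt-comm f e)) (tgt-comm g (fE f e))
  }

IsMatch : ∀ {A B} → Hom A B → Set
IsMatch f = Injective _≡_ _≡_ (fV f) × Injective _≡_ _≡_ (fE f)

Match : Graph → Graph → Set
Match A B = Σ (Hom A B) IsMatch

hom : ∀ {A B} → Match A B → Hom A B
hom = proj₁

-- Rule L ⇀ R : span L ← K → R of matches.
record Rule (L R : Graph) : Set where
  field
    K  : Graph
    r₁ : Match K L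
    r₂ : Match K R

open Rule public

_† : ∀ {L R} → Rule L R → Rule R L
α † = record { K = K α ; r₁ = r₂ α ; r₂ = r₁ α }

IsPullback : ∀ {P B C D} → Hom P B → Hom P C → Hom B D → Hom C D → Set
IsPullback {P} {B} {C} {D} p₁ p₂ h k =
  (h ∘ p₁ ≈ k ∘ p₂) ×
  (∀ (Q : Graph) (q₁ : Hom Q B) (q₂ : Hom Q C) → h ∘ q₁ ≈ k ∘ q₂ →
    Σ (Hom Q P) λ u → (p₁ ∘ u ≈ q₁) × (p₂ ∘ u ≈ q₂) ×
      (∀ (u' : Hom Q P) → p₁ ∘ u' ≈ q₁ → p₂ ∘ u' ≈ q₂ → u' ≈ u))

IsPushout : ∀ {A B C D} → Hom A B → Hom A C → Hom B D → Hom C D → Set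
IsPushout {A} {B} {C} {D} a₁ a₂ i₁ i₂ =
  (i₁ ∘ a₁ ≈ i₂ ∘ a₂) ×
  (∀ (Q : Graph) (q₁ : Hom B Q) (q₂ : Hom C Q) → q₁ ∘ a₁ ≈ q₂ ∘ a₂ →
    Σ (Hom D Q) λ u → (u ∘ i₁ ≈ q₁) × (u ∘ i₂ ≈ q₂) ×
      (∀ (u' : Hom D Q) → u' ∘ i₁ ≈ q₁ → u' ∘ i₂ ≈ q₂ → u' ≈ u))

-- (g₁ : X → W, g₂ : W → Z) is a final pullback complement of X -f₁-> Y -f₂-> Z.
IsFPBC : ∀ {X Y Z W} → Hom X Y → Hom Y Z → Hom X W → Hom W Z → Set
IsFPBC {X} {Y} {Z} {W} f₁ f₂ g₁ g₂ =
  IsPullback f₁ g₁ f₂ g₂ ×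
  (∀ (P Q : Graph) (f₁' : Hom P Y) (g₁' : Hom P Q) (g₂' : Hom Q Z) (p : Hom P X) →
    IsPullback f₁' g₁' f₂ g₂' → f₁ ∘ p ≈ f₁' →
    Σ (Hom Q W) λ u → (g₂ ∘ u ≈ g₂') × (u ∘ g₁' ≈ g₁ ∘ p) ×
      (∀ (u' : Hom Q W) → g₂ ∘ u' ≈ g₂' → u' ∘ g₁' ≈ g₁ ∘ p → u' ≈ u))

-- Derivation f ⇒_α g with corule β (β : G ⇀ H, with D = K β).
Derivation : ∀ {L R G H} → Rule L R → Match L G → Match R H → Rule G H → Set
Derivation α f g β =
  Σ (Match (K α) (K β)) λ h →
    IsFPBC (hom (r₁ α)) (hom f) (hom h) (hom (r₁ β)) ×
    IsPushout (hom (r₂ α)) (hom h) (hom g) (hom (r₂ β))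

Derivable : ∀ {L R T} → Rule L R → Match R T → Set
Derivable {L} {R} {T} α g₁ =
  Σ Graph λ X → Σ (Match L X) λ f' → Σ (Rule X T) λ δ → Derivation α f' g₁ δ

Over : ∀ {L S G} → Match L S → Match L G → Set
Over {L} {S} {G} f₁ f = Σ (Match S G) λ f₂ → hom f₂ ∘ hom f₁ ≈ hom f

OverSetoid : ∀ {L S G} → Match L S → Match L G → Setoid _ _
OverSetoid f₁ f = record
  { Carrier = Over f₁ f
  ; _≈_ = λ x y → hom (proj₁ x) ≈ hom (proj₁ y)
  ; isEquivalence = record
    { refl = (λ _ → refl) , (λ _ → refl)
    ; sym = λ p → (λ v → sym (proj₁ p v)) , (λ e → sym (proj₂ p e))
    ; trans = λ p q → (λ v → trans (proj₁ p v) (proj₁ q v)) , (λ e → trans (proj₂ p e) (proj₂ q e))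
    }
  }

Correspondence : ∀ {L S G R T H} → Match L S → Match L G → Match R T → Match R H → Set
Correspondence f₁ f g₁ g = Inverse (OverSetoid f₁ f) (OverSetoid g₁ g)

module Submission where

-- Let h : K → D and h′ : K → D′ be the context matches of the derivations f ⇒_α g and
-- g₁ ⇒_{α†} f₁, so that S = L +_K D′, H = R +_K D, and D, D′ are final pullback
-- complements of f ∘ α₁ and g₁ ∘ α₂.  Both M_L and M_R are in bijection with the set of
-- matches u : D′ → D with u ∘ h′ = h.  A match f₂ over f restricts along γ₁ to such a u by
-- finality of D, and u glues with f to a match S → G over f since S is a pushout.  On the
-- right, g₂ over g restricts along γ₂ because H is covered by g and β₂, and u glues with g
-- once T = R +_K D′ is known to be a pushout.  This is where derivability of g₁ is used: its
-- derivation yields a pushout complement of g₁ ∘ α₂, which factors through the final one D′.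

open import Defs
open import Data.Nat using (ℕ)
open import Data.Fin using (Fin; zero; suc; combine; remQuot)
open import Data.Fin.Properties using (any?; _≟_; remQuot-combine)
open import Data.Product using (Σ; _×_; _,_; proj₁; proj₂)
open import Data.Sum using (_⊎_; inj₁; inj₂)
open import Data.Empty using (⊥-elim)
open import Level using (0ℓ)
open import Relation.Nullary using (¬_; yes; no)
open import Relation.Binary.PropositionalEquality
  using (_≡_; _≢_; refl; sym; trans; cong; cong₂; module ≡-Reasoning)
open import Relation.Binary.Bundles using (Setoid)
import Relation.Binary.Reasoning.Setoid as SetoidReasoning
open import Function.Definitions using (Injective)
import Function.Construct.Composition as Composition
import Function.Construct.Symmetry as Symmetry

private variable
  A B C D P Q X : Graph

-- Graphs as two-sorted sets

data Sort : Set where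
  node edge : Sort

size : Graph → Sort → ℕ
size A node = nV A
size A edge = nE A

El : Graph → Sort → Set
El A s = Fin (size A s)

infixr 20 _⟨_⟩_

_⟨_⟩_ : Hom A B → (s : Sort) → El A s → El B s
f ⟨ node ⟩ x = fV f x
f ⟨ edge ⟩ x = fE f x

∘-⟨⟩ : (g : Hom B C) (f : Hom A B) (s : Sort) (x : El A s) → (g ∘ f) ⟨ s ⟩ x ≡ g ⟨ s ⟩ f ⟨ s ⟩ x
∘-⟨⟩ g f node x = refl
∘-⟨⟩ g f edge x = refl

-- Unlike _≈_, this is a record, so Agda can infer the morphisms from a proof of it.
infix 4 _≃_

record _≃_ (f g : Hom A B) : Set where
  constructor pointwise
  field at : ∀ s x → f ⟨ s ⟩ x ≡ g ⟨ s ⟩ x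

open _≃_ public

≈⇒≃ : {f g : Hom A B} → f ≈ g → f ≃ g
≈⇒≃ (eqV , eqE) = pointwise λ { node → eqV ; edge → eqE }

≃⇒≈ : {f g : Hom A B} → f ≃ g → f ≈ g
≃⇒≈ (pointwise eq) = eq node , eq edge

HomSetoid : Graph → Graph → Setoid 0ℓ 0ℓ
HomSetoid A B = record
  { Carrier = Hom A B
  ; _≈_ = _≃_
  ; isEquivalence = record
    { refl = pointwise λ _ _ → refl
    ; sym = λ (pointwise eq) → pointwise λ s x → sym (eq s x)
    ; trans = λ (pointwise eq) (pointwise eq′) → pointwise λ s x → trans (eq s x) (eq′ s x)
    }
  }

module _ {A B : Graph} where
  open Setoid (HomSetoid A B) public
    using () renaming (refl to ≃-refl; sym to ≃-sym; trans to ≃-trans)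

module ≃-Reasoning {A B : Graph} = SetoidReasoning (HomSetoid A B)

id : Hom A A
id = record { fV = λ v → v ; fE = λ e → e ; src-comm = λ _ → refl ; tgt-comm = λ _ → refl }

∘-identityʳ : (f : Hom A B) → f ∘ id ≃ f
∘-identityʳ f = pointwise λ { node _ → refl ; edge _ → refl }

∘-assoc : (h : Hom C D) (g : Hom B C) (f : Hom A B) → (h ∘ g) ∘ f ≃ h ∘ (g ∘ f)
∘-assoc h g f = pointwise λ { node _ → refl ; edge _ → refl }

∘-at : {g : Hom B C} {f : Hom A B} {k : Hom A C} → g ∘ f ≃ k → ∀ s x → g ⟨ s ⟩ f ⟨ s ⟩ x ≡ k ⟨ s ⟩ x
∘-at {g = g} {f} eq s x = trans (sym (∘-⟨⟩ g f s x)) (at eq s x)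

square-at : {g : Hom B D} {f : Hom A B} {g′ : Hom C D} {f′ : Hom A C} →
  g ∘ f ≃ g′ ∘ f′ → ∀ s x → g ⟨ s ⟩ f ⟨ s ⟩ x ≡ g′ ⟨ s ⟩ f′ ⟨ s ⟩ x
square-at {g′ = g′} {f′} eq s x = trans (∘-at eq s x) (∘-⟨⟩ g′ f′ s x)

pointwise-∘ : {g : Hom B C} {f : Hom A B} {k : Hom A C} →
  (∀ s x → g ⟨ s ⟩ f ⟨ s ⟩ x ≡ k ⟨ s ⟩ x) → g ∘ f ≃ k
pointwise-∘ {g = g} {f} eq = pointwise λ s x → trans (∘-⟨⟩ g f s x) (eq s x)

∘-congˡ : (h : Hom B C) {f g : Hom A B} → f ≃ g → h ∘ f ≃ h ∘ g
∘-congˡ h eq = pointwise-∘ λ s x → trans (cong (h ⟨ s ⟩_) (at eq s x)) (sym (∘-⟨⟩ h _ s x))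

∘-congʳ : {f g : Hom B C} → f ≃ g → (h : Hom A B) → f ∘ h ≃ g ∘ h
∘-congʳ eq h = pointwise-∘ λ s x → trans (at eq s (h ⟨ s ⟩ x)) (sym (∘-⟨⟩ _ h s x))

IsInjective : Hom A B → Set
IsInjective f = ∀ s → Injective _≡_ _≡_ (f ⟨ s ⟩_)

injective : (m : Match A B) → IsInjective (hom m)
injective m node = proj₁ (proj₂ m)
injective m edge = proj₂ (proj₂ m)

toMatch : (f : Hom A B) → IsInjective f → Match A B
toMatch f inj = f , inj node , inj edge

∘-injective-at : {g : Hom B C} {f : Hom A B} → IsInjective (g ∘ f) →
  ∀ s {x y} → g ⟨ s ⟩ f ⟨ s ⟩ x ≡ g ⟨ s ⟩ f ⟨ s ⟩ y → x ≡ y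
∘-injective-at {g = g} {f} gf-inj s eq = gf-inj s (trans (∘-⟨⟩ g f s _) (trans eq (sym (∘-⟨⟩ g f s _))))

∘-injective : {g : Hom B C} {f : Hom A B} → IsInjective g → IsInjective f → IsInjective (g ∘ f)
∘-injective {g = g} {f} g-inj f-inj s eq =
  f-inj s (g-inj s (trans (sym (∘-⟨⟩ g f s _)) (trans eq (∘-⟨⟩ g f s _))))

∘-injectiveʳ : (g : Hom B C) {f : Hom A B} → IsInjective (g ∘ f) → IsInjective f
∘-injectiveʳ g gf-inj s eq = ∘-injective-at gf-inj s (cong (g ⟨ s ⟩_) eq)

≃-injective : {f g : Hom A B} → f ≃ g → IsInjective g → IsInjective f
≃-injective f≃g g-inj s eq = g-inj s (trans (sym (at f≃g s _)) (trans eq (at f≃g s _)))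

cancelˡ : {m : Hom B C} {f g : Hom A B} → IsInjective m → m ∘ f ≃ m ∘ g → f ≃ g
cancelˡ m-inj eq = pointwise λ s x → m-inj s (square-at eq s x)

lift-through-injective : {m : Hom B C} → IsInjective m → (φ : Hom A C) (ψ : ∀ s → El A s → El B s) →
  (∀ s x → m ⟨ s ⟩ ψ s x ≡ φ ⟨ s ⟩ x) → Σ (Hom A B) λ u → ∀ s x → u ⟨ s ⟩ x ≡ ψ s x
lift-through-injective {B = B} {C} {A} {m} m-inj φ ψ mψ≡φ = u , λ { node _ → refl ; edge _ → refl }
  where
  open ≡-Reasoning
  u : Hom A B
  u = record
    { fV = ψ node
    ; fE = ψ edge
    ; src-comm = λ e → m-inj node (begin
        fV m (ψ node (src A e))   ≡⟨ mψ≡φ node (src A e) ⟩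
        fV φ (src A e)            ≡⟨ src-comm φ e ⟩
        src C (fE φ e)            ≡⟨ cong (src C) (mψ≡φ edge e) ⟨
        src C (fE m (ψ edge e))   ≡⟨ src-comm m (ψ edge e) ⟨
        fV m (src B (ψ edge e))   ∎)
    ; tgt-comm = λ e → m-inj node (begin
        fV m (ψ node (tgt A e))   ≡⟨ mψ≡φ node (tgt A e) ⟩
        fV φ (tgt A e)            ≡⟨ tgt-comm φ e ⟩
        tgt C (fE φ e)            ≡⟨ cong (tgt C) (mψ≡φ edge e) ⟨
        tgt C (fE m (ψ edge e))   ≡⟨ tgt-comm m (ψ edge e) ⟨
        fV m (tgt B (ψ edge e))   ∎)
    }

-- Pullbacks

-- Probe s represents the elements of sort s: morphisms Probe s → A are elements of A.
Probe : Sort → Graph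
Probe node = record { nV = 1 ; nE = 0 ; src = λ () ; tgt = λ () }
Probe edge = record { nV = 2 ; nE = 1 ; src = λ _ → zero ; tgt = λ _ → suc zero }

generic : (s : Sort) → El (Probe s) s
generic node = zero
generic edge = zero

probe : (s : Sort) → El A s → Hom (Probe s) A
probe node x = record { fV = λ _ → x ; fE = λ () ; src-comm = λ () ; tgt-comm = λ () }
probe {A} edge e = record { fV = ends ; fE = λ _ → e ; src-comm = λ _ → refl ; tgt-comm = λ _ → refl }
  where
  ends : Fin 2 → V A
  ends zero = src A e
  ends (suc zero) = tgt A e

probe-generic : (s : Sort) (x : El A s) → probe s x ⟨ s ⟩ generic s ≡ x
probe-generic node x = refl
probe-generic edge x = refl

∘-probe : (f : Hom A B) (s : Sort) (x : El A s) → f ∘ probe s x ≃ probe s (f ⟨ s ⟩ x)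
∘-probe f node x = pointwise λ { node _ → refl ; edge () }
∘-probe f edge x = pointwise λ { node zero → src-comm f x ; node (suc zero) → tgt-comm f x ; edge _ → refl }

PairsLift : Hom P B → Hom P C → Hom B D → Hom C D → Set
PairsLift {P} p₁ p₂ h k =
  ∀ s b c → h ⟨ s ⟩ b ≡ k ⟨ s ⟩ c → Σ (El P s) λ x → p₁ ⟨ s ⟩ x ≡ b × p₂ ⟨ s ⟩ x ≡ c

pairsLift⇒pullback : {p₁ : Hom P B} {p₂ : Hom P C} {h : Hom B D} {k : Hom C D} →
  IsInjective p₁ → h ∘ p₁ ≃ k ∘ p₂ → PairsLift p₁ p₂ h k → IsPullback p₁ p₂ h k
pairsLift⇒pullback {P = P} {p₁ = p₁} {p₂} {h} {k} p₁-inj commutes lift = ≃⇒≈ commutes , universal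
  where
  universal : ∀ Q (q₁ : Hom Q _) (q₂ : Hom Q _) → h ∘ q₁ ≈ k ∘ q₂ →
    Σ (Hom Q P) λ u → (p₁ ∘ u ≈ q₁) × (p₂ ∘ u ≈ q₂) × (∀ u′ → p₁ ∘ u′ ≈ q₁ → p₂ ∘ u′ ≈ q₂ → u′ ≈ u)
  universal Q q₁ q₂ hq₁≈kq₂ = u , ≃⇒≈ p₁u≃q₁ , ≃⇒≈ p₂u≃q₂ , unique
    where
    pair : ∀ s x → Σ (El P s) λ y → p₁ ⟨ s ⟩ y ≡ q₁ ⟨ s ⟩ x × p₂ ⟨ s ⟩ y ≡ q₂ ⟨ s ⟩ x
    pair s x = lift s _ _ (square-at (≈⇒≃ hq₁≈kq₂) s x)
    u-spec = lift-through-injective p₁-inj q₁ (λ s x → proj₁ (pair s x)) (λ s x → proj₁ (proj₂ (pair s x)))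
    u : Hom Q P
    u = proj₁ u-spec
    p₁u≃q₁ : p₁ ∘ u ≃ q₁
    p₁u≃q₁ = pointwise-∘ λ s x → trans (cong (p₁ ⟨ s ⟩_) (proj₂ u-spec s x)) (proj₁ (proj₂ (pair s x)))
    p₂u≃q₂ : p₂ ∘ u ≃ q₂
    p₂u≃q₂ = pointwise-∘ λ s x → trans (cong (p₂ ⟨ s ⟩_) (proj₂ u-spec s x)) (proj₂ (proj₂ (pair s x)))
    unique : ∀ u′ → p₁ ∘ u′ ≈ q₁ → p₂ ∘ u′ ≈ q₂ → u′ ≈ u
    unique u′ p₁u′≈q₁ _ = ≃⇒≈ (cancelˡ p₁-inj (≃-trans (≈⇒≃ {f = p₁ ∘ u′} p₁u′≈q₁) (≃-sym p₁u≃q₁)))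

module Pullback (p₁ : Hom P B) (p₂ : Hom P C) (h : Hom B D) (k : Hom C D)
                (pullback : IsPullback p₁ p₂ h k) where

  commutes : h ∘ p₁ ≃ k ∘ p₂
  commutes = ≈⇒≃ (proj₁ pullback)

  pairsLift : PairsLift p₁ p₂ h k
  pairsLift s b c hb≡kc =
      u ⟨ s ⟩ generic s
    , trans (∘-at (≈⇒≃ p₁u≈probe) s (generic s)) (probe-generic s b)
    , trans (∘-at (≈⇒≃ p₂u≈probe) s (generic s)) (probe-generic s c)
    where
    open ≃-Reasoning
    probes-agree : h ∘ probe s b ≃ k ∘ probe s c
    probes-agree = begin
      h ∘ probe s b          ≈⟨ ∘-probe h s b ⟩
      probe s (h ⟨ s ⟩ b)    ≡⟨ cong (probe s) hb≡kc ⟩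
      probe s (k ⟨ s ⟩ c)    ≈⟨ ∘-probe k s c ⟨
      k ∘ probe s c          ∎
    mediator = proj₂ pullback (Probe s) (probe s b) (probe s c) (≃⇒≈ probes-agree)
    u = proj₁ mediator
    p₁u≈probe = proj₁ (proj₂ mediator)
    p₂u≈probe = proj₁ (proj₂ (proj₂ mediator))

-- Pushouts

-- Morphisms A → Ω s are two-colourings of the elements of sort s of A: Ω node has one edge
-- for each ordered pair of colours, Ω edge is a single node with two loops.
Ω : Sort → Graph
Ω node = record { nV = 2 ; nE = 4 ; src = λ e → proj₁ (remQuot {2} 2 e) ; tgt = λ e → proj₂ (remQuot {2} 2 e) }
Ω edge = record { nV = 1 ; nE = 2 ; src = λ _ → zero ; tgt = λ _ → zero }

χ : (s : Sort) → (El A s → Fin 2) → Hom A (Ω s)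
χ {A} node c = record
  { fV = c
  ; fE = λ e → combine (c (src A e)) (c (tgt A e))
  ; src-comm = λ e → sym (cong proj₁ (remQuot-combine {k = 2} (c (src A e)) (c (tgt A e))))
  ; tgt-comm = λ e → sym (cong proj₂ (remQuot-combine {k = 2} (c (src A e)) (c (tgt A e))))
  }
χ edge c = record { fV = λ _ → zero ; fE = c ; src-comm = λ _ → refl ; tgt-comm = λ _ → refl }

χ-∘ : (s : Sort) (c : El B s → Fin 2) (f : Hom A B) → χ s c ∘ f ≃ χ s (λ x → c (f ⟨ s ⟩ x))
χ-∘ node c f = pointwise λ
  { node _ → refl
  ; edge e → sym (cong₂ combine (cong c (src-comm f e)) (cong c (tgt-comm f e))) }
χ-∘ edge c f = pointwise λ { node _ → refl ; edge _ → refl }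

χ-cong : (s : Sort) {c c′ : El A s → Fin 2} → (∀ x → c x ≡ c′ x) → χ s c ≃ χ s c′
χ-cong node c≗c′ = pointwise λ { node x → c≗c′ x ; edge e → cong₂ combine (c≗c′ _) (c≗c′ _) }
χ-cong edge c≗c′ = pointwise λ { node _ → refl ; edge e → c≗c′ e }

indicator : ∀ {n} → Fin n → Fin n → Fin 2
indicator x y with y ≟ x
... | yes _ = suc zero
... | no _ = zero

indicator-self : ∀ {n} (x : Fin n) → indicator x x ≡ suc zero
indicator-self x with x ≟ x
... | yes _ = refl
... | no x≢x = ⊥-elim (x≢x refl)

indicator-other : ∀ {n} {x y : Fin n} → y ≢ x → indicator x y ≡ zero
indicator-other {x = x} {y} y≢x with y ≟ x
... | yes y≡x = ⊥-elim (y≢x y≡x)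
... | no _ = refl

indicator-separates : (s : Sort) (x : El A s) (y : El B s) →
  χ s (indicator x) ⟨ s ⟩ x ≢ χ s (λ _ → zero) ⟨ s ⟩ y
indicator-separates node x y eq with () ← trans (sym (indicator-self x)) eq
indicator-separates edge x y eq with () ← trans (sym (indicator-self x)) eq

indicator-outside-image : (s : Sort) (i : Hom B D) (x : El D s) → ¬ (Σ (El B s) λ y → i ⟨ s ⟩ y ≡ x) →
  χ s (indicator x) ∘ i ≃ χ s (λ _ → zero) ∘ i
indicator-outside-image s i x x∉i = begin
  χ s (indicator x) ∘ i               ≈⟨ χ-∘ s (indicator x) i ⟩
  χ s (λ y → indicator x (i ⟨ s ⟩ y)) ≈⟨ χ-cong s (λ y → indicator-other (λ iy≡x → x∉i (y , iy≡x))) ⟩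
  χ s (λ _ → zero)                    ≈⟨ χ-∘ s (λ _ → zero) i ⟨
  χ s (λ _ → zero) ∘ i                ∎
  where open ≃-Reasoning

JointlySurjective : Hom B D → Hom C D → Set
JointlySurjective {B = B} {D} {C} i₁ i₂ =
  ∀ s (x : El D s) → (Σ (El B s) λ y → i₁ ⟨ s ⟩ y ≡ x) ⊎ (Σ (El C s) λ z → i₂ ⟨ s ⟩ z ≡ x)

injective-on-cover : {i₁ : Hom B D} {i₂ : Hom C D} → JointlySurjective i₁ i₂ → (t : Hom D Q) →
  IsInjective (t ∘ i₁) → IsInjective (t ∘ i₂) →
  (∀ s y z → t ⟨ s ⟩ i₁ ⟨ s ⟩ y ≡ t ⟨ s ⟩ i₂ ⟨ s ⟩ z → i₁ ⟨ s ⟩ y ≡ i₂ ⟨ s ⟩ z) →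
  IsInjective t
injective-on-cover {i₁ = i₁} {i₂} cover t ti₁-inj ti₂-inj glue s {x} {x′} tx≡tx′
  with cover s x | cover s x′
... | inj₁ (y , refl) | inj₁ (y′ , refl) = cong (i₁ ⟨ s ⟩_) (∘-injective-at ti₁-inj s tx≡tx′)
... | inj₂ (z , refl) | inj₂ (z′ , refl) = cong (i₂ ⟨ s ⟩_) (∘-injective-at ti₂-inj s tx≡tx′)
... | inj₁ (y , refl) | inj₂ (z , refl) = glue s y z tx≡tx′
... | inj₂ (z , refl) | inj₁ (y , refl) = sym (glue s y z (sym tx≡tx′))

module Pushout (a₁ : Hom A B) (a₂ : Hom A C) (i₁ : Hom B D) (i₂ : Hom C D)
               (pushout : IsPushout a₁ a₂ i₁ i₂) where

  commutes : i₁ ∘ a₁ ≃ i₂ ∘ a₂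
  commutes = ≈⇒≃ (proj₁ pushout)

  copair : (q₁ : Hom B Q) (q₂ : Hom C Q) → q₁ ∘ a₁ ≃ q₂ ∘ a₂ → Σ (Hom D Q) λ u → u ∘ i₁ ≃ q₁ × u ∘ i₂ ≃ q₂
  copair q₁ q₂ q₁a₁≃q₂a₂ with proj₂ pushout _ q₁ q₂ (≃⇒≈ q₁a₁≃q₂a₂)
  ... | u , ui₁≈q₁ , ui₂≈q₂ , _ = u , ≈⇒≃ ui₁≈q₁ , ≈⇒≃ ui₂≈q₂

  ext : (u v : Hom D Q) → u ∘ i₁ ≃ v ∘ i₁ → u ∘ i₂ ≃ v ∘ i₂ → u ≃ v
  ext {Q} u v ui₁≃vi₁ ui₂≃vi₂ =
    ≃-trans (≈⇒≃ {g = w} (unique u (≃⇒≈ ui₁≃vi₁) (≃⇒≈ ui₂≃vi₂)))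
            (≃-sym (≈⇒≃ {g = w} (unique v (≃⇒≈ {f = v ∘ i₁} ≃-refl) (≃⇒≈ {f = v ∘ i₂} ≃-refl))))
    where
    v-commutes : (v ∘ i₁) ∘ a₁ ≃ (v ∘ i₂) ∘ a₂
    v-commutes = begin
      (v ∘ i₁) ∘ a₁ ≈⟨ ∘-assoc v i₁ a₁ ⟩
      v ∘ (i₁ ∘ a₁) ≈⟨ ∘-congˡ v commutes ⟩
      v ∘ (i₂ ∘ a₂) ≈⟨ ∘-assoc v i₂ a₂ ⟨
      (v ∘ i₂) ∘ a₂ ∎
      where open ≃-Reasoning
    mediator = proj₂ pushout Q (v ∘ i₁) (v ∘ i₂) (≃⇒≈ v-commutes)
    w = proj₁ mediator
    unique = proj₂ (proj₂ (proj₂ mediator))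

  jointlySurjective : JointlySurjective i₁ i₂
  jointlySurjective s x with any? (λ y → i₁ ⟨ s ⟩ y ≟ x) | any? (λ z → i₂ ⟨ s ⟩ z ≟ x)
  ... | yes hit | _       = inj₁ hit
  ... | no _    | yes hit = inj₂ hit
  ... | no x∉i₁ | no x∉i₂ = ⊥-elim (indicator-separates s x x (at indicator≃zero s x))
    where
    indicator≃zero : χ s (indicator x) ≃ χ s (λ _ → zero)
    indicator≃zero = ext _ _ (indicator-outside-image s i₁ x x∉i₁) (indicator-outside-image s i₂ x x∉i₂)

  pairsLift : IsInjective i₂ → PairsLift a₁ a₂ i₁ i₂
  pairsLift i₂-inj s b c i₁b≡i₂c with any? (λ x → a₁ ⟨ s ⟩ x ≟ b)
  ... | yes (x , a₁x≡b) = x , a₁x≡b , i₂-inj s (begin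
    i₂ ⟨ s ⟩ a₂ ⟨ s ⟩ x ≡⟨ square-at commutes s x ⟨
    i₁ ⟨ s ⟩ a₁ ⟨ s ⟩ x ≡⟨ cong (i₁ ⟨ s ⟩_) a₁x≡b ⟩
    i₁ ⟨ s ⟩ b          ≡⟨ i₁b≡i₂c ⟩
    i₂ ⟨ s ⟩ c          ∎)
    where open ≡-Reasoning
  ... | no b∉a₁ = ⊥-elim (indicator-separates s b c (begin
    χ s (indicator b) ⟨ s ⟩ b ≡⟨ ∘-at ui₁≃indicator s b ⟨
    u ⟨ s ⟩ i₁ ⟨ s ⟩ b        ≡⟨ cong (u ⟨ s ⟩_) i₁b≡i₂c ⟩
    u ⟨ s ⟩ i₂ ⟨ s ⟩ c        ≡⟨ ∘-at ui₂≃zero s c ⟩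
    χ s (λ _ → zero) ⟨ s ⟩ c  ∎))
    where
    open ≡-Reasoning
    agree-on-A : χ s (indicator b) ∘ a₁ ≃ χ s (λ _ → zero) ∘ a₂
    agree-on-A = ≃-trans (indicator-outside-image s a₁ b b∉a₁)
                         (≃-trans (χ-∘ s (λ _ → zero) a₁) (≃-sym (χ-∘ s (λ _ → zero) a₂)))
    separating = copair (χ s (indicator b)) (χ s (λ _ → zero)) agree-on-A
    u = proj₁ separating
    ui₁≃indicator = proj₁ (proj₂ separating)
    ui₂≃zero = proj₂ (proj₂ separating)

  pullback : IsInjective a₁ → IsInjective i₂ → IsPullback a₁ a₂ i₁ i₂
  pullback a₁-inj i₂-inj = pairsLift⇒pullback a₁-inj commutes (pairsLift i₂-inj)

-- Final pullback complements

fpbc-mediate : (a : Hom X A) (n : Hom A P) (m : Hom X C) (b : Hom C P) → IsFPBC a n m b →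
  (m′ : Hom X D) (b′ : Hom D P) → IsPullback a m′ n b′ → Σ (Hom D C) λ w → b ∘ w ≃ b′ × w ∘ m′ ≃ m
fpbc-mediate a n m b (_ , final) m′ b′ pullback′
  with final _ _ a m′ b′ id pullback′ (≃⇒≈ (∘-identityʳ a))
... | w , bw≈b′ , wm′≈m∘id , _ = w , ≈⇒≃ bw≈b′ , ≃-trans (≈⇒≃ {g = m ∘ id} wm′≈m∘id) (∘-identityʳ m)

-- The pushout along m′ serves for m as well: b′ factors through b, and P is covered by n and b′.
fpbc⇒pushout : (a : Hom X A) (n : Hom A P) (m : Hom X C) (b : Hom C P) → IsFPBC a n m b → IsInjective b →
  (m′ : Hom X D) (b′ : Hom D P) → IsPushout a m′ n b′ → IsInjective a → IsInjective b′ →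
  IsPushout a m n b
fpbc⇒pushout {P = P} {C = C} a n m b fpbc b-inj m′ b′ pushout′ a-inj b′-inj = proj₁ (proj₁ fpbc) , universal
  where
  module Pb = Pullback a m n b (proj₁ fpbc)
  module Po′ = Pushout a m′ n b′ pushout′
  mediation = fpbc-mediate a n m b fpbc m′ b′ (Po′.pullback a-inj b′-inj)
  w = proj₁ mediation
  bw≃b′ = proj₁ (proj₂ mediation)
  wm′≃m = proj₂ (proj₂ mediation)

  universal : ∀ Q (q₁ : Hom _ Q) (q₂ : Hom C Q) → q₁ ∘ a ≈ q₂ ∘ m →
    Σ (Hom P Q) λ u → (u ∘ n ≈ q₁) × (u ∘ b ≈ q₂) × (∀ u′ → u′ ∘ n ≈ q₁ → u′ ∘ b ≈ q₂ → u′ ≈ u)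
  universal Q q₁ q₂ q₁a≈q₂m = u , ≃⇒≈ un≃q₁ , ≃⇒≈ (pointwise-∘ ub≡q₂) , unique
    where
    q₁a≃q₂wm′ : q₁ ∘ a ≃ (q₂ ∘ w) ∘ m′
    q₁a≃q₂wm′ = begin
      q₁ ∘ a         ≈⟨ ≈⇒≃ q₁a≈q₂m ⟩
      q₂ ∘ m         ≈⟨ ∘-congˡ q₂ wm′≃m ⟨
      q₂ ∘ (w ∘ m′)  ≈⟨ ∘-assoc q₂ w m′ ⟨
      (q₂ ∘ w) ∘ m′  ∎
      where open ≃-Reasoning
    extension = Po′.copair q₁ (q₂ ∘ w) q₁a≃q₂wm′
    u = proj₁ extension
    un≃q₁ = proj₁ (proj₂ extension)
    ub′≃q₂w = proj₂ (proj₂ extension)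

    ub≡q₂ : ∀ s d → u ⟨ s ⟩ b ⟨ s ⟩ d ≡ q₂ ⟨ s ⟩ d
    ub≡q₂ s d with Po′.jointlySurjective s (b ⟨ s ⟩ d)
    ... | inj₁ (y , ny≡bd) with Pb.pairsLift s y d ny≡bd
    ...   | x , refl , refl = begin
      u ⟨ s ⟩ b ⟨ s ⟩ m ⟨ s ⟩ x  ≡⟨ cong (u ⟨ s ⟩_) (square-at Pb.commutes s x) ⟨
      u ⟨ s ⟩ n ⟨ s ⟩ a ⟨ s ⟩ x  ≡⟨ ∘-at un≃q₁ s (a ⟨ s ⟩ x) ⟩
      q₁ ⟨ s ⟩ a ⟨ s ⟩ x         ≡⟨ square-at (≈⇒≃ q₁a≈q₂m) s x ⟩
      q₂ ⟨ s ⟩ m ⟨ s ⟩ x         ∎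
      where open ≡-Reasoning
    ub≡q₂ s d | inj₂ (d′ , b′d′≡bd) = begin
      u ⟨ s ⟩ b ⟨ s ⟩ d    ≡⟨ cong (u ⟨ s ⟩_) b′d′≡bd ⟨
      u ⟨ s ⟩ b′ ⟨ s ⟩ d′  ≡⟨ square-at ub′≃q₂w s d′ ⟩
      q₂ ⟨ s ⟩ w ⟨ s ⟩ d′  ≡⟨ cong (q₂ ⟨ s ⟩_) (b-inj s (trans (∘-at bw≃b′ s d′) b′d′≡bd)) ⟩
      q₂ ⟨ s ⟩ d           ∎
      where open ≡-Reasoning

    unique : ∀ u′ → u′ ∘ n ≈ q₁ → u′ ∘ b ≈ q₂ → u′ ≈ u
    unique u′ u′n≈q₁ u′b≈q₂ = ≃⇒≈ (Po′.ext u′ u (≃-trans (≈⇒≃ {g = q₁} u′n≈q₁) (≃-sym un≃q₁)) (begin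
      u′ ∘ b′        ≈⟨ ∘-congˡ u′ bw≃b′ ⟨
      u′ ∘ (b ∘ w)   ≈⟨ ∘-assoc u′ b w ⟨
      (u′ ∘ b) ∘ w   ≈⟨ ∘-congʳ (≈⇒≃ {f = u′ ∘ b} {g = q₂} u′b≈q₂) w ⟩
      q₂ ∘ w         ≈⟨ ub′≃q₂w ⟨
      u ∘ b′         ∎))
      where open ≃-Reasoning

-- Correspondence of matches

over-commutes : (n : Match A P) (k : Match A Q) (x : Over n k) → hom (proj₁ x) ∘ hom n ≃ hom k
over-commutes n k x = ≈⇒≃ (proj₂ x)

over-reflects : (n : Match A P) (k : Match A Q) (x : Over n k) (b : Hom C P) →
  ∀ s y z → hom k ⟨ s ⟩ y ≡ (hom (proj₁ x) ∘ b) ⟨ s ⟩ z → hom n ⟨ s ⟩ y ≡ b ⟨ s ⟩ z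
over-reflects n k x@(k₂ , _) b s y z ky≡k₂bz = injective k₂ s (begin
  hom k₂ ⟨ s ⟩ hom n ⟨ s ⟩ y  ≡⟨ ∘-at (over-commutes n k x) s y ⟩
  hom k ⟨ s ⟩ y               ≡⟨ ky≡k₂bz ⟩
  (hom k₂ ∘ b) ⟨ s ⟩ z        ≡⟨ ∘-⟨⟩ (hom k₂) b s z ⟩
  hom k₂ ⟨ s ⟩ b ⟨ s ⟩ z      ∎)
  where open ≡-Reasoning

ExtensionsFactor : Match A P → Match A Q → Hom C P → Hom D Q → Set
ExtensionsFactor {C = C} {D = D} n k b c = (x : Over n k) → Σ (Hom C D) λ u → c ∘ u ≃ hom (proj₁ x) ∘ b

fpbc⇒extensionsFactor : (a : Hom X A) (m : Hom X C) (n : Match A P) (b : Hom C P) →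
  IsInjective a → IsPullback a m (hom n) b →
  (h : Hom X D) (k : Match A Q) (c : Hom D Q) → IsFPBC a (hom k) h c →
  ExtensionsFactor n k b c
fpbc⇒extensionsFactor a m n b a-inj pullback h k c fpbc x@(k₂ , _) =
  proj₁ mediation , proj₁ (proj₂ mediation)
  where
  module Pb = Pullback a m (hom n) b pullback
  commutes′ : hom k ∘ a ≃ (hom k₂ ∘ b) ∘ m
  commutes′ = begin
    hom k ∘ a                  ≈⟨ ∘-congʳ (over-commutes n k x) a ⟨
    (hom k₂ ∘ hom n) ∘ a       ≈⟨ ∘-assoc (hom k₂) (hom n) a ⟩
    hom k₂ ∘ (hom n ∘ a)       ≈⟨ ∘-congˡ (hom k₂) Pb.commutes ⟩
    hom k₂ ∘ (b ∘ m)           ≈⟨ ∘-assoc (hom k₂) b m ⟨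
    (hom k₂ ∘ b) ∘ m           ∎
    where open ≃-Reasoning
  pairsLift′ : PairsLift a m (hom k) (hom k₂ ∘ b)
  pairsLift′ s y z ky≡k₂bz = Pb.pairsLift s y z (over-reflects n k x b s y z ky≡k₂bz)
  mediation = fpbc-mediate a (hom k) h c fpbc m (hom k₂ ∘ b) (pairsLift⇒pullback a-inj commutes′ pairsLift′)

pushout⇒extensionsFactor : (a : Hom X A) (m : Hom X C) (n : Match A P) (b : Hom C P) →
  IsPullback a m (hom n) b →
  (h : Hom X D) (k : Match A Q) (c : Hom D Q) → IsPushout a h (hom k) c → IsInjective c →
  ExtensionsFactor n k b c
pushout⇒extensionsFactor {D = D} a m n b pullback h k c pushout c-inj x@(k₂ , _) =
  u , pointwise-∘ λ s d → trans (cong (c ⟨ s ⟩_) (proj₂ lifted s d)) (proj₂ (preimage s d))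
  where
  module Pb = Pullback a m (hom n) b pullback
  module Po = Pushout a h (hom k) c pushout
  preimage : ∀ s d → Σ (El D s) λ e → c ⟨ s ⟩ e ≡ (hom k₂ ∘ b) ⟨ s ⟩ d
  preimage s d with Po.jointlySurjective s ((hom k₂ ∘ b) ⟨ s ⟩ d)
  ... | inj₂ hit = hit
  ... | inj₁ (y , ky≡k₂bd) with Pb.pairsLift s y d (over-reflects n k x b s y d ky≡k₂bd)
  ...   | z , refl , refl = h ⟨ s ⟩ z , trans (sym (square-at Po.commutes s z)) ky≡k₂bd
  lifted = lift-through-injective c-inj (hom k₂ ∘ b) (λ s d → proj₁ (preimage s d)) (λ s d → proj₂ (preimage s d))
  u = proj₁ lifted

-- Restrict along b, and conversely glue with k along the pushout.
module OverCorrespondence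
  (a : Hom X A) (m : Match X C) (n : Match A P) (b : Match C P)
  (h : Match X D) (k : Match A Q) (c : Match D Q)
  (pushout : IsPushout a (hom m) (hom n) (hom b))
  (pullback : IsPullback a (hom h) (hom k) (hom c))
  (factor : ExtensionsFactor n k (hom b) (hom c))
  where

  module Po = Pushout a (hom m) (hom n) (hom b) pushout
  module Pb = Pullback a (hom h) (hom k) (hom c) pullback

  restriction : Over n k → Hom C D
  restriction x = proj₁ (factor x)

  restriction-spec : (x : Over n k) → hom c ∘ restriction x ≃ hom (proj₁ x) ∘ hom b
  restriction-spec x = proj₂ (factor x)

  restrict : Over n k → Over m h
  restrict x@(k₂ , _) = toMatch u u-inj , ≃⇒≈ (cancelˡ (injective c) cum≃ch)
    where
    u = restriction x
    u-inj : IsInjective u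
    u-inj = ∘-injectiveʳ (hom c) (≃-injective (restriction-spec x) (∘-injective (injective k₂) (injective b)))
    cum≃ch : hom c ∘ (u ∘ hom m) ≃ hom c ∘ hom h
    cum≃ch = begin
      hom c ∘ (u ∘ hom m)        ≈⟨ ∘-assoc (hom c) u (hom m) ⟨
      (hom c ∘ u) ∘ hom m        ≈⟨ ∘-congʳ (restriction-spec x) (hom m) ⟩
      (hom k₂ ∘ hom b) ∘ hom m   ≈⟨ ∘-assoc (hom k₂) (hom b) (hom m) ⟩
      hom k₂ ∘ (hom b ∘ hom m)   ≈⟨ ∘-congˡ (hom k₂) Po.commutes ⟨
      hom k₂ ∘ (hom n ∘ a)       ≈⟨ ∘-assoc (hom k₂) (hom n) a ⟨
      (hom k₂ ∘ hom n) ∘ a       ≈⟨ ∘-congʳ (over-commutes n k x) a ⟩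
      hom k ∘ a                  ≈⟨ Pb.commutes ⟩
      hom c ∘ hom h              ∎
      where open ≃-Reasoning

  glue : (y : Over m h) → Σ (Hom P Q) λ t → t ∘ hom n ≃ hom k × t ∘ hom b ≃ hom c ∘ hom (proj₁ y)
  glue (u , um≈h) = Po.copair (hom k) (hom c ∘ hom u) (begin
    hom k ∘ a               ≈⟨ Pb.commutes ⟩
    hom c ∘ hom h           ≈⟨ ∘-congˡ (hom c) (≈⇒≃ um≈h) ⟨
    hom c ∘ (hom u ∘ hom m) ≈⟨ ∘-assoc (hom c) (hom u) (hom m) ⟨
    (hom c ∘ hom u) ∘ hom m ∎)
    where open ≃-Reasoning

  extension : Over m h → Hom P Q
  extension y = proj₁ (glue y)

  extension-n : (y : Over m h) → extension y ∘ hom n ≃ hom k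
  extension-n y = proj₁ (proj₂ (glue y))

  extension-b : (y : Over m h) → extension y ∘ hom b ≃ hom c ∘ hom (proj₁ y)
  extension-b y = proj₂ (proj₂ (glue y))

  extend : Over m h → Over n k
  extend y@(u , um≈h) = toMatch t t-inj , ≃⇒≈ (extension-n y)
    where
    t = extension y
    meet : ∀ s z w → t ⟨ s ⟩ hom n ⟨ s ⟩ z ≡ t ⟨ s ⟩ hom b ⟨ s ⟩ w → hom n ⟨ s ⟩ z ≡ hom b ⟨ s ⟩ w
    meet s z w tnz≡tbw with Pb.pairsLift s z (hom u ⟨ s ⟩ w)
                              (trans (sym (∘-at (extension-n y) s z)) (trans tnz≡tbw (square-at (extension-b y) s w)))
    ... | x , refl , hx≡uw = trans (square-at Po.commutes s x) (cong (hom b ⟨ s ⟩_) mx≡w)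
      where
      mx≡w : hom m ⟨ s ⟩ x ≡ w
      mx≡w = injective u s (trans (∘-at (≈⇒≃ um≈h) s x) hx≡uw)
    t-inj : IsInjective t
    t-inj = injective-on-cover Po.jointlySurjective t
      (≃-injective (extension-n y) (injective k))
      (≃-injective (extension-b y) (∘-injective (injective c) (injective u)))
      meet

  restrict-cong : {x x′ : Over n k} → hom (proj₁ x) ≈ hom (proj₁ x′) → restriction x ≈ restriction x′
  restrict-cong {x} {x′} k₂≈k₂′ = ≃⇒≈ (cancelˡ (injective c) (begin
    hom c ∘ restriction x     ≈⟨ restriction-spec x ⟩
    hom (proj₁ x) ∘ hom b     ≈⟨ ∘-congʳ (≈⇒≃ {f = hom (proj₁ x)} {g = hom (proj₁ x′)} k₂≈k₂′) (hom b) ⟩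
    hom (proj₁ x′) ∘ hom b    ≈⟨ restriction-spec x′ ⟨
    hom c ∘ restriction x′    ∎))
    where open ≃-Reasoning

  extend-cong : {y y′ : Over m h} → hom (proj₁ y) ≈ hom (proj₁ y′) → extension y ≈ extension y′
  extend-cong {y} {y′} u≈u′ = ≃⇒≈ (Po.ext (extension y) (extension y′)
    (≃-trans (extension-n y) (≃-sym (extension-n y′)))
    (begin
      extension y ∘ hom b       ≈⟨ extension-b y ⟩
      hom c ∘ hom (proj₁ y)     ≈⟨ ∘-congˡ (hom c) (≈⇒≃ u≈u′) ⟩
      hom c ∘ hom (proj₁ y′)    ≈⟨ extension-b y′ ⟨
      extension y′ ∘ hom b      ∎))
    where open ≃-Reasoning

  restrict-inverse : {y : Over m h} {x : Over n k} → hom (proj₁ x) ≈ extension y → restriction x ≈ hom (proj₁ y)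
  restrict-inverse {y} {x} k₂≈t = ≃⇒≈ (cancelˡ (injective c) (begin
    hom c ∘ restriction x     ≈⟨ restriction-spec x ⟩
    hom (proj₁ x) ∘ hom b     ≈⟨ ∘-congʳ (≈⇒≃ {f = hom (proj₁ x)} {g = extension y} k₂≈t) (hom b) ⟩
    extension y ∘ hom b       ≈⟨ extension-b y ⟩
    hom c ∘ hom (proj₁ y)     ∎))
    where open ≃-Reasoning

  extend-inverse : {x : Over n k} {y : Over m h} → hom (proj₁ y) ≈ restriction x → extension y ≈ hom (proj₁ x)
  extend-inverse {x} {y} u≈r = ≃⇒≈ (Po.ext (extension y) (hom (proj₁ x))
    (≃-trans (extension-n y) (≃-sym (over-commutes n k x)))
    (begin
      extension y ∘ hom b       ≈⟨ extension-b y ⟩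
      hom c ∘ hom (proj₁ y)     ≈⟨ ∘-congˡ (hom c) (≈⇒≃ u≈r) ⟩
      hom c ∘ restriction x     ≈⟨ restriction-spec x ⟩
      hom (proj₁ x) ∘ hom b     ∎))
    where open ≃-Reasoning

  correspondence : Correspondence n k m h
  correspondence = record
    { to        = restrict
    ; from      = extend
    ; to-cong   = λ {x} {x′} → restrict-cong {x} {x′}
    ; from-cong = λ {y} {y′} → extend-cong {y} {y′}
    ; inverse   = (λ {y} {x} → restrict-inverse {y} {x}) , (λ {x} {y} → extend-inverse {x} {y})
    }

lemma6 : ∀ {L R G H S T : Graph}
    (α : Rule L R) (β : Rule G H) (γ : Rule S T)
    (f : Match L G) (g : Match R H) (f₁ : Match L S) (g₁ : Match R T) →
    Derivation α f g β →
    Derivation (α †) g₁ f₁ (γ †) →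
    Derivable α g₁ →
    Correspondence f₁ f g₁ g
lemma6 α β γ f g f₁ g₁ (h , fpbc , po) (h′ , fpbc′ , po′) (_ , _ , δ , h″ , _ , po″) =
  Composition.inverse left (Symmetry.inverse right)
  where
  α₁ = hom (r₁ α)
  α₂ = hom (r₂ α)

  left : Correspondence f₁ f h′ h
  left = OverCorrespondence.correspondence α₁ h′ f₁ (r₁ γ) h f (r₁ β) po′ (proj₁ fpbc)
    (fpbc⇒extensionsFactor α₁ (hom h′) f₁ (hom (r₁ γ)) (injective (r₁ α))
      (Pushout.pullback α₁ (hom h′) (hom f₁) (hom (r₁ γ)) po′ (injective (r₁ α)) (injective (r₁ γ)))
      (hom h) f (hom (r₁ β)) fpbc)

  g₁-pushout : IsPushout α₂ (hom h′) (hom g₁) (hom (r₂ γ))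
  g₁-pushout = fpbc⇒pushout α₂ (hom g₁) (hom h′) (hom (r₂ γ)) fpbc′ (injective (r₂ γ))
    (hom h″) (hom (r₂ δ)) po″ (injective (r₂ α)) (injective (r₂ δ))

  right : Correspondence g₁ g h′ h
  right = OverCorrespondence.correspondence α₂ h′ g₁ (r₂ γ) h g (r₂ β) g₁-pushout
    (Pushout.pullback α₂ (hom h) (hom g) (hom (r₂ β)) po (injective (r₂ α)) (injective (r₂ β)))
    (pushout⇒extensionsFactor α₂ (hom h′) g₁ (hom (r₂ γ)) (proj₁ fpbc′) (hom h) g (hom (r₂ β)) po (injective (r₂ β)))
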